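{- Let $n\ge2$, $0\le k\le n$ and $0\le r<n$ be integers with $\gcd(n,k,r)=1$. Then $|\bar S_r(n,k)| = |\bar S_1(n,k)|$ and $|N_r(n,k)| = |N_1(n,k)|$.
   Context: $\bar S_r(n,k)$ is the set of $k$-element subsets of $[n]=\{1,\dots,n\}$ the sum of whose elements is congruent to $r$ modulo $n$. A binary necklace of length $n$ is an equivalence class of words in $\{0,1\}^n$ under cyclic rotation. A word $u$ has co-period $j$ if $u=v^j$ with $v$ primitive (not a power $w^i$ with $i\ge2$); all words in a necklace have the same co-period. $N_r(n,k)$ is the set of binary necklaces of length $n$ with exactly $k$ ones whose co-period divides $r$ (every positive integer divides $0$). -}

module Defs where

open import Data.Bool using (Bool; true; false)
open import Data.Nat using (ℕ; zero; suc; _+_; _*_; _≤_; ∣_-_∣)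
open import Data.Nat.Divisibility using (_∣_)
open import Data.Fin using (Fin; toℕ)
open import Data.Fin.Subset using (Subset; _∈_; ∣_∣)
open import Data.Fin.Subset.Properties using (_∈?_)
open import Data.List using (List; []; _∷_; _++_; [_]; length; concat; replicate; filter; map; allFin)
open import Data.Nat.ListAction using (sum)
open import Data.List.Relation.Unary.Any using (Any)
open import Data.List.Relation.Unary.All using (All)
open import Data.List.Relation.Unary.AllPairs using (AllPairs)
import Data.List.Membership.Propositional as LM
open import Data.List.Relation.Unary.Unique.Propositional using (Unique)
open import Data.Product using (Σ; ∃; _×_; ∃-syntax)
open import Data.Bool using (T)
open import Function.Bundles using (_⇔_)
open import Relation.Nullary using (¬_)
open import Relation.Binary.PropositionalEquality using (_≡_)

CongMod : ℕ → ℕ → ℕ → Set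
CongMod n a b = n ∣ ∣ a - b ∣

HasCard : {A : Set} → (A → Set) → ℕ → Set
HasCard {A} P m = ∃[ L ] (length L ≡ m × Unique L × (∀ x → (x LM.∈ L) ⇔ P x))

-- Subsets of [n] = {1,…,n}: a subset p : Subset n of Fin n, where
-- i : Fin n stands for the element toℕ i + 1 of [n].

elemSum : {n : ℕ} → Subset n → ℕ
elemSum {n} p = sum (map (λ i → suc (toℕ i)) (filter (_∈? p) (allFin n)))

SbarR : (n k r : ℕ) → Subset n → Set
SbarR n k r p = ∣ p ∣ ≡ k × CongMod n (elemSum p) r

Word : Set
Word = List Bool

ones : Word → ℕ
ones u = length (filter T? u) where
  open import Data.Bool.Properties using (T?)

rot : Word → Word
rot []       = []
rot (x ∷ xs) = xs ++ [ x ]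

rotN : ℕ → Word → Word
rotN zero    u = u
rotN (suc i) u = rotN i (rot u)

_∼_ : Word → Word → Set
u ∼ w = ∃[ i ] rotN i u ≡ w

pow : Word → ℕ → Word
pow v j = concat (replicate j v)

Primitive : Word → Set
Primitive v = ¬ (∃[ w ] ∃[ i ] (2 ≤ i × v ≡ pow w i))

HasCoPeriod : Word → ℕ → Set
HasCoPeriod u j = ∃[ v ] (Primitive v × u ≡ pow v j)

-- word of length n with k ones whose co-period divides r
-- (this predicate is invariant under rotation, so it describes a set of necklaces)
NWord : (n k r : ℕ) → Word → Set
NWord n k r u = length u ≡ n × ones u ≡ k × ∃[ j ] (HasCoPeriod u j × j ∣ r)

-- The set of necklaces (∼-classes) of words satisfying P has exactly m
-- elements: there is a list of m words satisfying P, pairwise inequivalent,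
-- meeting every class of words satisfying P.
NecklaceCard : (Word → Set) → ℕ → Set
NecklaceCard P m =
  ∃[ L ] (length L ≡ m × All P L × AllPairs (λ u w → ¬ (u ∼ w)) L
          × (∀ u → P u → Any (u ∼_) L))

{-# OPTIONS --safe #-}
module Submission where

-- Put g = gcd n k. Since gcd g r = 1, some v makes a = r + g v a unit modulo n (take v to be
-- the part of n coprime to r), and Bézout gives b with b k ≡ - g v, so that a + b k ≡ r (mod n).
-- The permutation x ↦ a x + b of [n], applied elementwise, preserves the size k of a subset and
-- sends its element sum s to a s + b k, so it maps S̄₁(n,k) bijectively onto S̄ᵣ(n,k).
-- The co-period of a word of length n with k ones divides n and k; if it also divides r, then it
-- is 1. Hence N_r(n,k) and N_1(n,k) are the same set of primitive necklaces.

open import Data.Bool using (Bool; true; false; if_then_else_)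
import Data.Bool as Bool
open import Data.Fin as Fin using (Fin; toℕ)
open import Data.Fin.Permutation using (Permutation′; permutation; _⟨$⟩ʳ_; _⟨$⟩ˡ_; inverseˡ; flip)
open import Data.Fin.Properties using (toℕ-fromℕ<; toℕ-injective; toℕ<n)
open import Data.Fin.Subset using (Subset; ∣_∣)
open import Data.Fin.Subset.Properties using (_∈?_)
open import Data.List using (List; []; _∷_; _++_; [_]; length; filter; take; map; deduplicate; cartesianProductWith)
import Data.List as List
open import Data.List.Membership.Propositional using (_∈_)
open import Data.List.Membership.Propositional.Properties
  using (∈-map⁺; ∈-map⁻; ∈-cartesianProductWith⁺; ∈-filter⁺; ∈-filter⁻)
open import Data.List.Membership.Setoid.Properties using (∈-deduplicate⁺)
open import Data.List.Properties using (length-map; length-++; length-++-≤ˡ; filter-++; ++-identityʳ; ++-assoc; ≡-dec)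
open import Data.List.Relation.Unary.All using ([]; _∷_)
import Data.List.Relation.Unary.All as All
import Data.List.Relation.Unary.All.Properties as All
open import Data.List.Relation.Unary.AllPairs using ([]; _∷_)
open import Data.List.Relation.Unary.Any as Any using (Any; here; there)
open import Data.List.Relation.Unary.Unique.DecSetoid.Properties using (deduplicate-!)
open import Data.List.Relation.Unary.Unique.Propositional using (Unique)
import Data.List.Relation.Unary.Unique.Propositional.Properties as Unique
open import Data.Nat
  using (ℕ; zero; suc; pred; _+_; _*_; _∸_; _≤_; _<_; _≤?_; NonZero; >-nonZero⁻¹; ∣_-_∣; z≤n; s≤s; s≤s⁻¹)
import Data.Nat as ℕ
open import Data.Nat.Coprimality as Coprime using (Coprime; coprime-divisor)
open import Data.Nat.DivMod
  using (_%_; _/_; _mod_; %-distribˡ-+; %-distribˡ-*; %-remove-+ʳ; [m+kn]%n≡m%n; m%n%n≡m%n; m%n<n; m<n⇒m%n≡m;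
         m≡m%n+[m/n]*n)
open import Data.Nat.Divisibility using (_∣_; _∣?_; divides; ∣-refl; ∣-trans; ∣m+n∣m⇒∣n; n∣m*n; ∣1⇒≡1; 1∣_)
open import Data.Nat.GCD using (gcd; gcd-GCD; gcd-greatest; gcd[m,n]∣m; gcd[m,n]∣n; gcd[m,n]≡0⇒m≡0; module Bézout)
open import Data.Nat.Induction using (<-rec)
open import Data.Nat.ListAction using (sum)
open import Data.Nat.Properties
  using (+-0-commutativeMonoid; *-assoc; *-comm; *-distribʳ-∣-∣; *-identityʳ; *-identityˡ; *-zeroʳ; +-assoc; +-comm;
         +-identityʳ; +-suc; <-irrefl; >⇒≢; anyUpTo?; m+[n∸m]≡n; m<m*n; m≤m*n; m≤n+m; m≤n⇒m≤1+n; m≤n⇒∃[o]m+o≡n;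
         suc-pred; ∣-∣-comm; ∣m+n-m+o∣≡∣n-o∣; ∣m-m+n∣≡n; ≤-refl; ≤-total; ≤-trans)
open import Algebra.Properties.CommutativeMonoid.Sum +-0-commutativeMonoid using (sum-syntax; sum-cong-≗; sum-permute)
open import Data.Nat.Tactic.RingSolver using (solve-∀)
open import Data.Product using (∃-syntax; _×_; _,_; proj₁; proj₂)
open import Data.Sum using (inj₁; inj₂)
open import Data.Vec using (Vec; []; _∷_; lookup; tabulate; toList; fromList)
open import Data.Vec.Properties using (∷-injective; lookup∘tabulate; tabulate∘lookup; tabulate-cong; toList∘fromList)
open import Function.Base using (_∘_)
open import Function.Bundles using (_⇔_; mk⇔; _↔_; mk↔ₛ′; Inverse; Equivalence)
open import Relation.Binary.Bundles using (Setoid; DecSetoid)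
open import Relation.Binary.Structures using (IsEquivalence)
open import Relation.Binary.PropositionalEquality as ≡ using (_≡_; refl; cong; cong₂; subst)
open import Relation.Nullary using (¬_; Dec; ¬?; does; yes; no; contradiction)
open import Relation.Nullary.Decidable using (_×-dec_; map′)
open import Relation.Unary using (Decidable)
open import Defs

allVecs : ∀ n → List (Vec Bool n)
allVecs zero    = List.[ [] ]
allVecs (suc n) = cartesianProductWith _∷_ (true ∷ false ∷ List.[]) (allVecs n)

∈-allVecs : ∀ {n} (v : Vec Bool n) → v ∈ allVecs n
∈-allVecs []      = here refl
∈-allVecs (b ∷ v) = ∈-cartesianProductWith⁺ _∷_ (∈-bools b) (∈-allVecs v)
  where
  ∈-bools : ∀ b → b ∈ true ∷ false ∷ List.[]
  ∈-bools true  = here refl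
  ∈-bools false = there (here refl)

allVecs-unique : ∀ n → Unique (allVecs n)
allVecs-unique zero    = [] ∷ []
allVecs-unique (suc n) =
  Unique.cartesianProductWith⁺ _∷_ ∷-injective (((λ ()) ∷ []) ∷ [] ∷ []) (allVecs-unique n)

hasCard-filter : ∀ {A : Set} {P : A → Set} (xs : List A) → Unique xs → (∀ x → x ∈ xs) → Decidable P →
  ∃[ m ] HasCard P m
hasCard-filter xs xs! ∈xs P? = _ , filter P? xs , refl , Unique.filter⁺ P? xs! ,
  λ x → mk⇔ (proj₂ ∘ ∈-filter⁻ P? {xs = xs}) (∈-filter⁺ P? (∈xs x))

hasCard-↔ : ∀ {A B : Set} {P : A → Set} {Q : B → Set} (f : A ↔ B) →
  (∀ x → P x ⇔ Q (Inverse.to f x)) → ∀ {m} → HasCard P m → HasCard Q m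
hasCard-↔ {P = P} {Q = Q} f P⇔Qf (xs , ∣xs∣≡m , xs! , ∈xs⇔P) =
  map to xs , ≡.trans (length-map to xs) ∣xs∣≡m , Unique.map⁺ to-injective xs! , λ y → mk⇔ (⇒Q y) (Q⇒ y)
  where
  open Inverse f using (to; from; strictlyInverseˡ; strictlyInverseʳ)
  to-injective : ∀ {x y} → to x ≡ to y → x ≡ y
  to-injective {x} {y} tx≡ty =
    ≡.trans (≡.sym (strictlyInverseʳ x)) (≡.trans (cong from tx≡ty) (strictlyInverseʳ y))
  ⇒Q : ∀ y → y ∈ map to xs → Q y
  ⇒Q y y∈ with x , x∈xs , refl ← ∈-map⁻ to y∈ = Equivalence.to (P⇔Qf x) (Equivalence.to (∈xs⇔P x) x∈xs)
  Q⇒ : ∀ y → Q y → y ∈ map to xs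
  Q⇒ y Qy = subst (_∈ map to xs) (strictlyInverseˡ y) (∈-map⁺ to (Equivalence.from (∈xs⇔P (from y)) P[from-y]))
    where
    P[from-y] : P (from y)
    P[from-y] = Equivalence.from (P⇔Qf (from y)) (subst Q (≡.sym (strictlyInverseˡ y)) Qy)

-- Sums over subsets of Fin m

label : ∀ {m} → Fin m → ℕ
label i = suc (toℕ i)

subsetSum : ∀ {m} → (Fin m → ℕ) → Subset m → ℕ
subsetSum {m} f p = ∑[ i < m ] (if lookup p i then f i else 0)

does-∈? : ∀ {m} (i : Fin m) (p : Subset m) → does (i ∈? p) ≡ lookup p i
does-∈? Fin.zero    (true ∷ p)  = refl
does-∈? Fin.zero    (false ∷ p) = refl
does-∈? (Fin.suc i) (_ ∷ p)     = does-∈? i p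

sum-filter-tabulate : ∀ {k m} (p : Subset m) (f : Fin k → Fin m) (g : Fin m → ℕ) →
  sum (map g (filter (_∈? p) (List.tabulate f))) ≡ ∑[ j < k ] (if lookup p (f j) then g (f j) else 0)
sum-filter-tabulate {zero}  p f g = refl
sum-filter-tabulate {suc k} p f g with f Fin.zero ∈? p | does-∈? (f Fin.zero) p
... | yes _ | true≡p[f0] rewrite ≡.sym true≡p[f0] =
  cong (g (f Fin.zero) +_) (sum-filter-tabulate p (f ∘ Fin.suc) g)
... | no _  | false≡p[f0] rewrite ≡.sym false≡p[f0] = sum-filter-tabulate p (f ∘ Fin.suc) g

elemSum≡subsetSum : ∀ {m} (p : Subset m) → elemSum p ≡ subsetSum label p
elemSum≡subsetSum p = sum-filter-tabulate p (λ i → i) label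

∣p∣≡subsetSum : ∀ {m} (p : Subset m) → ∣ p ∣ ≡ subsetSum (λ _ → 1) p
∣p∣≡subsetSum []          = refl
∣p∣≡subsetSum (true ∷ p)  = cong suc (∣p∣≡subsetSum p)
∣p∣≡subsetSum (false ∷ p) = ∣p∣≡subsetSum p

subsetSum-linear : ∀ {m} a b (f g : Fin m → ℕ) p →
  subsetSum (λ i → a * f i + b * g i) p ≡ a * subsetSum f p + b * subsetSum g p
subsetSum-linear a b f g []          = ≡.sym (cong₂ _+_ (*-zeroʳ a) (*-zeroʳ b))
subsetSum-linear a b f g (false ∷ p) = subsetSum-linear a b (f ∘ Fin.suc) (g ∘ Fin.suc) p
subsetSum-linear a b f g (true ∷ p)  = ≡.trans
  (cong (a * f Fin.zero + b * g Fin.zero +_) (subsetSum-linear a b (f ∘ Fin.suc) (g ∘ Fin.suc) p))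
  (regroup a b (f Fin.zero) (g Fin.zero) (subsetSum (f ∘ Fin.suc) p) (subsetSum (g ∘ Fin.suc) p))
  where
  regroup : ∀ a b x y z w → a * x + b * y + (a * z + b * w) ≡ a * (x + z) + b * (y + w)
  regroup = solve-∀

image : ∀ {m} → Permutation′ m → Subset m → Subset m
image π p = tabulate (lookup p ∘ (π ⟨$⟩ˡ_))

lookup-image : ∀ {m} (π : Permutation′ m) (p : Subset m) i → lookup (image π p) (π ⟨$⟩ʳ i) ≡ lookup p i
lookup-image π p i =
  ≡.trans (lookup∘tabulate (lookup p ∘ (π ⟨$⟩ˡ_)) (π ⟨$⟩ʳ i)) (cong (lookup p) (inverseˡ π))

image-flip : ∀ {m} (π : Permutation′ m) (p : Subset m) → image (flip π) (image π p) ≡ p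
image-flip π p = ≡.trans (tabulate-cong (lookup-image π p)) (tabulate∘lookup p)

image↔ : ∀ {m} → Permutation′ m → Subset m ↔ Subset m
image↔ π = mk↔ₛ′ (image π) (image (flip π)) (image-flip (flip π)) (image-flip π)

subsetSum-image : ∀ {m} (π : Permutation′ m) f p → subsetSum f (image π p) ≡ subsetSum (f ∘ (π ⟨$⟩ʳ_)) p
subsetSum-image π f p = ≡.trans (sum-permute _ π)
  (sum-cong-≗ λ i → cong (λ s → if s then f (π ⟨$⟩ʳ i) else 0) (lookup-image π p i))

∣image∣ : ∀ {m} (π : Permutation′ m) p → ∣ image π p ∣ ≡ ∣ p ∣
∣image∣ π p =
  ≡.trans (∣p∣≡subsetSum (image π p)) (≡.trans (subsetSum-image π _ p) (≡.sym (∣p∣≡subsetSum p)))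

-- A unit of the form r + g v

coprime-* : ∀ {x u v} → Coprime x u → Coprime x v → Coprime x (u * v)
coprime-* {x} x⊥u x⊥v (d∣x , d∣uv) = x⊥v (d∣x , coprime-divisor d⊥u d∣uv)
  where
  d⊥u : Coprime _ _
  d⊥u (e∣d , e∣u) = x⊥u (∣-trans e∣d d∣x , e∣u)

-- Holds exactly when every prime factor of u divides r.
RadicalDivides : ℕ → ℕ → Set
RadicalDivides u r = ∀ {x} → Coprime x r → Coprime x u

∣⇒radicalDivides : ∀ {u r} → u ∣ r → RadicalDivides u r
∣⇒radicalDivides u∣r x⊥r (d∣x , d∣u) = x⊥r (d∣x , ∣-trans d∣u u∣r)

radicalDivides-* : ∀ {u v r} → RadicalDivides u r → RadicalDivides v r → RadicalDivides (u * v) r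
radicalDivides-* rad-u∣r rad-v∣r x⊥r = coprime-* (rad-u∣r x⊥r) (rad-v∣r x⊥r)

nontrivial-common-divisor : ∀ {m r} → 0 < m → ¬ Coprime m r → ∃[ d ] (1 < d × (d ∣ m) × (d ∣ r))
nontrivial-common-divisor {m} {r} 0<m ¬m⊥r with gcd m r in gcd≡d
... | 0 = contradiction (gcd[m,n]≡0⇒m≡0 gcd≡d) (>⇒≢ 0<m)
... | 1 = contradiction (λ {_} → Coprime.gcd≡1⇒coprime gcd≡d) ¬m⊥r
... | d@(suc (suc _)) =
  d , s≤s (s≤s z≤n) , subst (_∣ m) gcd≡d (gcd[m,n]∣m m r) , subst (_∣ r) gcd≡d (gcd[m,n]∣n m r)

radicalDivides-coprime-factorisation : ∀ r m → 0 < m →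
  ∃[ u ] ∃[ v ] (u * v ≡ m × RadicalDivides u r × Coprime v r)
radicalDivides-coprime-factorisation r = <-rec _ split
  where
  Split : ℕ → Set
  Split m = ∃[ u ] ∃[ v ] (u * v ≡ m × RadicalDivides u r × Coprime v r)
  split : ∀ m → (∀ {m′} → m′ < m → 0 < m′ → Split m′) → 0 < m → Split m
  split m rec 0<m with Coprime.coprime? m r
  ... | yes m⊥r = 1 , m , *-identityˡ m , (λ _ → Coprime.sym (Coprime.1-coprimeTo _)) , m⊥r
  ... | no ¬m⊥r with nontrivial-common-divisor 0<m ¬m⊥r
  ...   | d , 1<d , divides zero refl , _ = contradiction 0<m (<-irrefl refl)
  ...   | d , 1<d , divides q@(suc _) refl , d∣r
          with u , v , uv≡q , rad-u∣r , v⊥r ← rec (m<m*n q d 1<d) (s≤s z≤n) =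
    d * u , v , uv≡m , radicalDivides-* (∣⇒radicalDivides d∣r) rad-u∣r , v⊥r
    where
    uv≡m : d * u * v ≡ q * d
    uv≡m = ≡.trans (*-assoc d u v) (≡.trans (cong (d *_) uv≡q) (*-comm d q))

coprime-shift : ∀ {g r} n → 0 < n → Coprime g r → ∃[ v ] Coprime (r + g * v) n
coprime-shift {g} {r} n 0<n g⊥r
  with u , v , refl , rad-u∣r , v⊥r ← radicalDivides-coprime-factorisation r n 0<n =
  v , coprime-* (rad-u∣r (Coprime.coprime-+ gv⊥r)) r+gv⊥v
  where
  gv⊥r : Coprime (g * v) r
  gv⊥r = Coprime.sym (coprime-* (Coprime.sym g⊥r) (Coprime.sym v⊥r))
  r+gv⊥v : Coprime (r + g * v) v
  r+gv⊥v {d} (d∣r+gv , d∣v) =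
    v⊥r (d∣v , ∣m+n∣m⇒∣n (subst (d ∣_) (+-comm r (g * v)) d∣r+gv) (∣-trans d∣v (n∣m*n g)))

-- Arithmetic modulo n and affine permutations of [n]

module Modular (n : ℕ) .{{_ : NonZero n}} where

  -- A record rather than x % n ≡ y % n, so that x and y can be inferred from a proof of x ≋ y.
  infix 4 _≋_
  record _≋_ (x y : ℕ) : Set where
    constructor mod-≡
    field %-≡ : x % n ≡ y % n
  open _≋_

  ≡⇒≋ : ∀ {x y} → x ≡ y → x ≋ y
  ≡⇒≋ x≡y = mod-≡ (cong (_% n) x≡y)

  ≋-isEquivalence : IsEquivalence _≋_
  ≋-isEquivalence = record
    { refl  = mod-≡ refl
    ; sym   = λ x≋y → mod-≡ (≡.sym (%-≡ x≋y))
    ; trans = λ x≋y y≋z → mod-≡ (≡.trans (%-≡ x≋y) (%-≡ y≋z))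
    }

  ≋-setoid : Setoid _ _
  ≋-setoid = record { isEquivalence = ≋-isEquivalence }

  open IsEquivalence ≋-isEquivalence public
    using () renaming (refl to ≋-refl; sym to ≋-sym; trans to ≋-trans)

  %-≋ : ∀ x → x % n ≋ x
  %-≋ x = mod-≡ (m%n%n≡m%n x n)

  +-*n-≋ : ∀ x k → x + k * n ≋ x
  +-*n-≋ x k = mod-≡ ([m+kn]%n≡m%n x k n)

  *n-≋0 : ∀ k → k * n ≋ 0
  *n-≋0 = +-*n-≋ 0

  +-cong : ∀ {a b c d} → a ≋ b → c ≋ d → a + c ≋ b + d
  +-cong {a} {b} {c} {d} (mod-≡ a≡b) (mod-≡ c≡d) = mod-≡ (begin
    (a + c) % n               ≡⟨ %-distribˡ-+ a c n ⟩
    (a % n + c % n) % n       ≡⟨ cong₂ (λ x y → (x + y) % n) a≡b c≡d ⟩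
    (b % n + d % n) % n       ≡⟨ %-distribˡ-+ b d n ⟨
    (b + d) % n               ∎)
    where open ≡.≡-Reasoning

  *-cong : ∀ {a b c d} → a ≋ b → c ≋ d → a * c ≋ b * d
  *-cong {a} {b} {c} {d} (mod-≡ a≡b) (mod-≡ c≡d) = mod-≡ (begin
    (a * c) % n               ≡⟨ %-distribˡ-* a c n ⟩
    (a % n * (c % n)) % n     ≡⟨ cong₂ (λ x y → (x * y) % n) a≡b c≡d ⟩
    (b % n * (d % n)) % n     ≡⟨ %-distribˡ-* b d n ⟨
    (b * d) % n               ∎)
    where open ≡.≡-Reasoning

  +-≋ : ∀ x {d} → n ∣ d → x + d ≋ x
  +-≋ x n∣d = mod-≡ (%-remove-+ʳ x n∣d)

  congMod⇒≋ : ∀ {x y} → CongMod n x y → x ≋ y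
  congMod⇒≋ {x} {y} n∣∣x-y∣ with ≤-total y x
  ... | inj₁ y≤x with d , refl ← m≤n⇒∃[o]m+o≡n y≤x =
    +-≋ y (subst (n ∣_) (≡.trans (∣-∣-comm (y + d) y) (∣m-m+n∣≡n y d)) n∣∣x-y∣)
  ... | inj₂ x≤y with d , refl ← m≤n⇒∃[o]m+o≡n x≤y =
    ≋-sym (+-≋ x (subst (n ∣_) (∣m-m+n∣≡n x d) n∣∣x-y∣))

  ≋⇒congMod : ∀ {x y} → x ≋ y → CongMod n x y
  ≋⇒congMod {x} {y} (mod-≡ x%n≡y%n) = divides ∣ x / n - y / n ∣ (begin
    ∣ x - y ∣                                  ≡⟨ cong₂ ∣_-_∣ (m≡m%n+[m/n]*n x n) (m≡m%n+[m/n]*n y n) ⟩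
    ∣ x % n + x / n * n - y % n + y / n * n ∣  ≡⟨ cong (λ t → ∣ x % n + x / n * n - t + y / n * n ∣) x%n≡y%n ⟨
    ∣ x % n + x / n * n - x % n + y / n * n ∣  ≡⟨ ∣m+n-m+o∣≡∣n-o∣ (x % n) _ _ ⟩
    ∣ x / n * n - y / n * n ∣                  ≡⟨ *-distribʳ-∣-∣ n (x / n) (y / n) ⟨
    ∣ x / n - y / n ∣ * n                      ∎)
    where open ≡.≡-Reasoning

  open import Relation.Binary.Reasoning.Setoid ≋-setoid

  +-inverse : ∀ x → x + pred n * x ≋ 0
  +-inverse x = begin
    x + pred n * x   ≡⟨ cong (_* x) (suc-pred n) ⟩
    n * x            ≡⟨ *-comm n x ⟩
    x * n            ≈⟨ *n-≋0 x ⟩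
    0                ∎

  +-cancelʳ : ∀ {x y} z → x + z ≋ y + z → x ≋ y
  +-cancelʳ {x} {y} z x+z≋y+z = begin
    x                          ≡⟨ +-identityʳ x ⟨
    x + 0                      ≈⟨ +-cong (≋-refl {x}) (+-inverse z) ⟨
    x + (z + pred n * z)       ≡⟨ +-assoc x z _ ⟨
    x + z + pred n * z         ≈⟨ +-cong x+z≋y+z ≋-refl ⟩
    y + z + pred n * z         ≡⟨ +-assoc y z _ ⟩
    y + (z + pred n * z)       ≈⟨ +-cong (≋-refl {y}) (+-inverse z) ⟩
    y + 0                      ≡⟨ +-identityʳ y ⟩
    y                          ∎

  +-cancelˡ : ∀ {x y} z → z + x ≋ z + y → x ≋ y
  +-cancelˡ {x} {y} z z+x≋z+y =
    +-cancelʳ z (≋-trans (≡⇒≋ (+-comm x z)) (≋-trans z+x≋z+y (≡⇒≋ (+-comm z y))))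

  +-inverse-unique : ∀ {x y} → x + y ≋ 0 → y ≋ pred n * x
  +-inverse-unique {x} {y} x+y≋0 = +-cancelʳ x (begin
    y + x              ≡⟨ +-comm y x ⟩
    x + y              ≈⟨ x+y≋0 ⟩
    0                  ≈⟨ +-inverse x ⟨
    x + pred n * x     ≡⟨ +-comm x _ ⟩
    pred n * x + x     ∎)

  *-cancelˡ : ∀ {a a′ x y} → a * a′ ≋ 1 → a * x ≋ a * y → x ≋ y
  *-cancelˡ {a} {a′} {x} {y} aa′≋1 ax≋ay = begin
    x                  ≡⟨ *-identityˡ x ⟨
    1 * x              ≈⟨ *-cong aa′≋1 ≋-refl ⟨
    a * a′ * x         ≡⟨ reassoc a a′ x ⟩
    a′ * (a * x)       ≈⟨ *-cong (≋-refl {a′}) ax≋ay ⟩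
    a′ * (a * y)       ≡⟨ reassoc a a′ y ⟨
    a * a′ * y         ≈⟨ *-cong aa′≋1 ≋-refl ⟩
    1 * y              ≡⟨ *-identityˡ y ⟩
    y                  ∎
    where
    reassoc : ∀ a a′ x → a * a′ * x ≡ a′ * (a * x)
    reassoc = solve-∀

  ∃-inverse : ∀ {a} → Coprime a n → ∃[ a′ ] a * a′ ≋ 1
  ∃-inverse {a} a⊥n with Coprime.coprime-Bézout a⊥n
  ... | Bézout.+- x y 1+yn≡xa = x , (begin
    a * x              ≡⟨ *-comm a x ⟩
    x * a              ≡⟨ 1+yn≡xa ⟨
    1 + y * n          ≈⟨ +-*n-≋ 1 y ⟩
    1                  ∎)
  ... | Bézout.-+ x y 1+xa≡yn = pred n * x , (begin
    a * (pred n * x)   ≡⟨ reorder a (pred n) x ⟩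
    pred n * (x * a)   ≈⟨ +-inverse-unique xa+1≋0 ⟨
    1                  ∎)
    where
    xa+1≋0 : x * a + 1 ≋ 0
    xa+1≋0 = ≋-trans (≡⇒≋ (≡.trans (+-comm (x * a) 1) 1+xa≡yn)) (*n-≋0 y)
    reorder : ∀ a p x → a * (p * x) ≡ p * (x * a)
    reorder = solve-∀

  ∃-*k+gcd≋0 : ∀ k → ∃[ b ] b * k + gcd n k ≋ 0
  ∃-*k+gcd≋0 k with Bézout.identity (gcd-GCD n k)
  ... | Bézout.+- x y g+yk≡xn = y , ≋-trans (≡⇒≋ (≡.trans (+-comm (y * k) _) g+yk≡xn)) (*n-≋0 x)
  ... | Bézout.-+ x y g+xn≡yk = pred n * y , (begin
    pred n * y * k + gcd n k       ≈⟨ +-cong (≋-refl {pred n * y * k}) g≋yk ⟩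
    pred n * y * k + y * k         ≡⟨ reorder (pred n) y k ⟩
    y * k + pred n * (y * k)       ≈⟨ +-inverse (y * k) ⟩
    0                              ∎)
    where
    g≋yk : gcd n k ≋ y * k
    g≋yk = ≋-trans (≋-sym (+-*n-≋ (gcd n k) x)) (≡⇒≋ g+xn≡yk)
    reorder : ∀ p y k → p * y * k + y * k ≡ y * k + p * (y * k)
    reorder = solve-∀

  affine-parameters : ∀ k r → gcd (gcd n k) r ≡ 1 →
    ∃[ a ] ∃[ a′ ] ∃[ b ] (a * a′ ≋ 1 × a * 1 + b * k ≋ r)
  affine-parameters k r gcd≡1
    with v , a⊥n ← coprime-shift {gcd n k} n (>-nonZero⁻¹ n) (Coprime.gcd≡1⇒coprime gcd≡1)
    with a′ , aa′≋1 ← ∃-inverse a⊥n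
    with b , bk+g≋0 ← ∃-*k+gcd≋0 k
    = r + gcd n k * v , a′ , b * v , aa′≋1 , (begin
    (r + gcd n k * v) * 1 + b * v * k ≡⟨ reorder r (gcd n k) v b k ⟩
    r + (b * k + gcd n k) * v       ≈⟨ +-cong (≋-refl {r}) (*-cong bk+g≋0 (≋-refl {v})) ⟩
    r + 0                           ≡⟨ +-identityʳ r ⟩
    r                               ∎)
    where
    reorder : ∀ r g v b k → (r + g * v) * 1 + b * v * k ≡ r + (b * k + g) * v
    reorder = solve-∀

  subsetSum-cong : ∀ {m} {f g : Fin m → ℕ} → (∀ i → f i ≋ g i) → ∀ p → subsetSum f p ≋ subsetSum g p
  subsetSum-cong f≋g []          = ≋-refl
  subsetSum-cong f≋g (true ∷ p)  = +-cong (f≋g Fin.zero) (subsetSum-cong (f≋g ∘ Fin.suc) p)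
  subsetSum-cong f≋g (false ∷ p) = subsetSum-cong (f≋g ∘ Fin.suc) p

  label-injective : ∀ {i j : Fin n} → label i ≋ label j → i ≡ j
  label-injective {i} {j} ℓi≋ℓj = toℕ-injective
    (≡.trans (≡.sym (m<n⇒m%n≡m (toℕ<n i)))
      (≡.trans (%-≡ (+-cancelˡ 1 ℓi≋ℓj)) (m<n⇒m%n≡m (toℕ<n j))))

  -- On labels this is ℓ ↦ a ℓ + b; adding pred n compensates for label i = toℕ i + 1.
  affine : ℕ → ℕ → Fin n → Fin n
  affine a b i = (a * label i + b + pred n) mod n

  label-affine : ∀ a b i → label (affine a b i) ≋ a * label i + b
  label-affine a b i = begin
    suc (toℕ ((x + pred n) mod n))   ≡⟨ cong suc (toℕ-fromℕ< _) ⟩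
    1 + (x + pred n) % n             ≈⟨ +-cong (≋-refl {1}) (%-≋ (x + pred n)) ⟩
    1 + (x + pred n)                 ≡⟨ +-suc x (pred n) ⟨
    x + suc (pred n)                 ≡⟨ cong (x +_) (suc-pred n) ⟩
    x + n                            ≈⟨ +-≋ x ∣-refl ⟩
    x                                ∎
    where x = a * label i + b

  affine-∘ : ∀ a b c d i → label (affine c d (affine a b i)) ≋ c * a * label i + (c * b + d)
  affine-∘ a b c d i = begin
    label (affine c d (affine a b i))    ≈⟨ label-affine c d (affine a b i) ⟩
    c * label (affine a b i) + d         ≈⟨ +-cong (*-cong (≋-refl {c}) (label-affine a b i)) (≋-refl {d}) ⟩
    c * (a * label i + b) + d            ≡⟨ distrib c a (label i) b d ⟩
    c * a * label i + (c * b + d)        ∎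
    where
    distrib : ∀ c a x b d → c * (a * x + b) + d ≡ c * a * x + (c * b + d)
    distrib = solve-∀

  affine-∘-id : ∀ a b c d → c * a ≋ 1 → c * b + d ≋ 0 → ∀ i → affine c d (affine a b i) ≡ i
  affine-∘-id a b c d ca≋1 cb+d≋0 i = label-injective (begin
    label (affine c d (affine a b i))    ≈⟨ affine-∘ a b c d i ⟩
    c * a * label i + (c * b + d)        ≈⟨ +-cong (*-cong ca≋1 (≋-refl {label i})) cb+d≋0 ⟩
    1 * label i + 0                      ≡⟨ +-identityʳ _ ⟩
    1 * label i                          ≡⟨ *-identityˡ _ ⟩
    label i                              ∎)

  module _ (a a′ : ℕ) (aa′≋1 : a * a′ ≋ 1) (b : ℕ) where

    -- pred n * (a′ * b) ≡ - a′ b, so on labels this is ℓ ↦ a′ (ℓ - b).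
    affine⁻¹ : Fin n → Fin n
    affine⁻¹ = affine a′ (pred n * (a′ * b))

    affine⁻¹∘affine : ∀ i → affine⁻¹ (affine a b i) ≡ i
    affine⁻¹∘affine =
      affine-∘-id a b a′ (pred n * (a′ * b)) (≋-trans (≡⇒≋ (*-comm a′ a)) aa′≋1) (+-inverse (a′ * b))

    affine∘affine⁻¹ : ∀ j → affine a b (affine⁻¹ j) ≡ j
    affine∘affine⁻¹ = affine-∘-id a′ (pred n * (a′ * b)) a b aa′≋1 (begin
      a * (pred n * (a′ * b)) + b     ≡⟨ reorder a a′ b (pred n) ⟩
      pred n * (a * a′ * b) + b       ≈⟨ +-cong (*-cong (≋-refl {pred n}) (*-cong aa′≋1 ≋-refl)) (≋-refl {b}) ⟩
      pred n * (1 * b) + b            ≡⟨ cong (λ x → pred n * x + b) (*-identityˡ b) ⟩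
      pred n * b + b                  ≡⟨ +-comm _ b ⟩
      b + pred n * b                  ≈⟨ +-inverse b ⟩
      0                               ∎)
      where
      reorder : ∀ a a′ b p → a * (p * (a′ * b)) + b ≡ p * (a * a′ * b) + b
      reorder = solve-∀

    affine-permutation : Permutation′ n
    affine-permutation = permutation (affine a b) affine⁻¹ affine∘affine⁻¹ affine⁻¹∘affine

    elemSum-image : ∀ p → elemSum (image affine-permutation p) ≋ a * elemSum p + b * ∣ p ∣
    elemSum-image p = begin
      elemSum (image affine-permutation p)           ≡⟨ elemSum≡subsetSum (image affine-permutation p) ⟩
      subsetSum label (image affine-permutation p)   ≡⟨ subsetSum-image affine-permutation label p ⟩
      subsetSum (label ∘ affine a b) p               ≈⟨ subsetSum-cong label-affine′ p ⟩
      subsetSum (λ i → a * label i + b * 1) p        ≡⟨ subsetSum-linear a b label (λ _ → 1) p ⟩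
      a * subsetSum label p + b * subsetSum _ p
        ≡⟨ cong₂ (λ s c → a * s + b * c) (elemSum≡subsetSum p) (∣p∣≡subsetSum p) ⟨
      a * elemSum p + b * ∣ p ∣                      ∎
      where
      label-affine′ : ∀ i → label (affine a b i) ≋ a * label i + b * 1
      label-affine′ i = ≋-trans (label-affine a b i) (≡⇒≋ (cong (a * label i +_) (≡.sym (*-identityʳ b))))

    sbar-image : ∀ {k s t} → a * s + b * k ≋ t → ∀ p → SbarR n k s p ⇔ SbarR n k t (image affine-permutation p)
    sbar-image {k} {s} {t} as+bk≋t p = mk⇔ to from
      where
      ∣image∣≡∣p∣ = ∣image∣ affine-permutation p
      to : SbarR n k s p → SbarR n k t (image affine-permutation p)
      to (∣p∣≡k , Σp≡s) = ≡.trans ∣image∣≡∣p∣ ∣p∣≡k , ≋⇒congMod (begin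
        elemSum (image affine-permutation p)   ≈⟨ elemSum-image p ⟩
        a * elemSum p + b * ∣ p ∣
          ≈⟨ +-cong (*-cong (≋-refl {a}) (congMod⇒≋ Σp≡s)) (≡⇒≋ (cong (b *_) ∣p∣≡k)) ⟩
        a * s + b * k                         ≈⟨ as+bk≋t ⟩
        t                                     ∎)
      from : SbarR n k t (image affine-permutation p) → SbarR n k s p
      from (∣image∣≡k , Σimage≡t) =
        ∣p∣≡k , ≋⇒congMod (*-cancelˡ {a} {a′} aa′≋1 (+-cancelʳ (b * k) aΣp+bk≋as+bk))
        where
        ∣p∣≡k = ≡.trans (≡.sym ∣image∣≡∣p∣) ∣image∣≡k
        aΣp+bk≋as+bk : a * elemSum p + b * k ≋ a * s + b * k
        aΣp+bk≋as+bk = begin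
          a * elemSum p + b * k                 ≡⟨ cong (λ c → a * elemSum p + b * c) ∣p∣≡k ⟨
          a * elemSum p + b * ∣ p ∣             ≈⟨ elemSum-image p ⟨
          elemSum (image affine-permutation p)   ≈⟨ congMod⇒≋ Σimage≡t ⟩
          t                                     ≈⟨ as+bk≋t ⟨
          a * s + b * k                         ∎

sbar? : ∀ n .{{_ : NonZero n}} k s → Decidable (SbarR n k s)
sbar? n k s p = (∣ p ∣ ℕ.≟ k) ×-dec (n ∣? ∣ elemSum p - s ∣)

sbar-equinumerous : ∀ n .{{_ : NonZero n}} k r → gcd (gcd n k) r ≡ 1 →
  ∃[ m ] (HasCard (SbarR n k r) m × HasCard (SbarR n k 1) m)
sbar-equinumerous n k r gcd≡1 =
  let open Modular n
      a , a′ , b , aa′≋1 , a+bk≋r = affine-parameters k r gcd≡1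
      m , card₁ = hasCard-filter (allVecs n) (allVecs-unique n) ∈-allVecs (sbar? n k 1)
      π = affine-permutation a a′ aa′≋1 b
  in m , hasCard-↔ (image↔ π) (sbar-image a a′ aa′≋1 b a+bk≋r) card₁ , card₁

-- Words and necklaces

infix 4 _≟ʷ_
_≟ʷ_ : (u w : Word) → Dec (u ≡ w)
_≟ʷ_ = ≡-dec Bool._≟_

ones-++ : ∀ xs ys → ones (xs ++ ys) ≡ ones xs + ones ys
ones-++ xs ys = ≡.trans (cong length (filter-++ _ xs ys)) (length-++ (filter _ xs))

pow-additive : (h : Word → ℕ) → h [] ≡ 0 → (∀ xs ys → h (xs ++ ys) ≡ h xs + h ys) →
  ∀ v j → h (pow v j) ≡ j * h v
pow-additive h h[]≡0 h-++ v zero    = h[]≡0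
pow-additive h h[]≡0 h-++ v (suc j) =
  ≡.trans (h-++ v (pow v j)) (cong (h v +_) (pow-additive h h[]≡0 h-++ v j))

length-pow : ∀ v j → length (pow v j) ≡ j * length v
length-pow = pow-additive length refl (λ xs _ → length-++ xs)

ones-pow : ∀ v j → ones (pow v j) ≡ j * ones v
ones-pow = pow-additive ones refl ones-++

coPeriod-∣-length : ∀ {u j} → HasCoPeriod u j → j ∣ length u
coPeriod-∣-length {j = j} (v , _ , refl) = divides (length v) (≡.trans (length-pow v j) (*-comm j (length v)))

coPeriod-∣-ones : ∀ {u j} → HasCoPeriod u j → j ∣ ones u
coPeriod-∣-ones {j = j} (v , _ , refl) = divides (ones v) (≡.trans (ones-pow v j) (*-comm j (ones v)))

hasCoPeriod-1⇔primitive : ∀ u → HasCoPeriod u 1 ⇔ Primitive u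
hasCoPeriod-1⇔primitive u = mk⇔
  (λ { (v , v-primitive , refl) → subst Primitive (≡.sym (++-identityʳ v)) v-primitive })
  (λ u-primitive → u , u-primitive , ≡.sym (++-identityʳ u))

nword-1⇔primitive : ∀ n k u → NWord n k 1 u ⇔ (length u ≡ n × ones u ≡ k × Primitive u)
nword-1⇔primitive n k u = mk⇔
  (λ { (∣u∣≡n , ones≡k , j , u-coPeriod , j∣1) →
       ∣u∣≡n , ones≡k ,
       Equivalence.to (hasCoPeriod-1⇔primitive u) (subst (HasCoPeriod u) (∣1⇒≡1 j∣1) u-coPeriod) })
  (λ { (∣u∣≡n , ones≡k , u-primitive) →
       ∣u∣≡n , ones≡k , 1 , Equivalence.from (hasCoPeriod-1⇔primitive u) u-primitive , ∣-refl })

coPeriod≡1 : ∀ {u j r} → gcd (gcd (length u) (ones u)) r ≡ 1 → HasCoPeriod u j → j ∣ r → j ≡ 1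
coPeriod≡1 {j = j} gcd≡1 u-coPeriod j∣r = ∣1⇒≡1 (subst (j ∣_) gcd≡1
  (gcd-greatest (gcd-greatest (coPeriod-∣-length u-coPeriod) (coPeriod-∣-ones u-coPeriod)) j∣r))

nword-1⇔nword-r : ∀ {n k r} → gcd (gcd n k) r ≡ 1 → ∀ u → NWord n k 1 u ⇔ NWord n k r u
nword-1⇔nword-r {r = r} gcd≡1 u = mk⇔
  (λ { (∣u∣≡n , ones≡k , j , u-coPeriod , j∣1) →
       ∣u∣≡n , ones≡k , j , u-coPeriod , ∣-trans j∣1 (1∣ r) })
  (λ { (refl , refl , j , u-coPeriod , j∣r) →
       refl , refl , 1 , subst (HasCoPeriod u) (coPeriod≡1 gcd≡1 u-coPeriod j∣r) u-coPeriod , ∣-refl })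

ProperPower : Word → Set
ProperPower v = ∃[ w ] ∃[ i ] (2 ≤ i × v ≡ pow w i)

pow-[] : ∀ i → pow [] i ≡ []
pow-[] zero    = refl
pow-[] (suc i) = pow-[] i

take-length-++ : ∀ (xs ys : Word) → take (length xs) (xs ++ ys) ≡ xs
take-length-++ []       ys = refl
take-length-++ (x ∷ xs) ys = cong (x ∷_) (take-length-++ xs ys)

-- The root of a proper power u is a prefix of u, and the exponent is at most length u
-- unless u = [] = pow [] 2.
ProperPowerBounded : Word → Set
ProperPowerBounded u =
  ∃[ d ] (d < suc (length u) × ∃[ i ] (i < 3 + length u × 2 ≤ i × u ≡ pow (take d u) i))

properPower⇒bounded : ∀ {u} → ProperPower u → ProperPowerBounded u
properPower⇒bounded ([] , i , 2≤i , refl) rewrite pow-[] i =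
  0 , s≤s z≤n , 2 , s≤s (s≤s (s≤s z≤n)) , ≤-refl , refl
properPower⇒bounded {u} (w@(_ ∷ _) , i@(suc i′) , 2≤i , refl) =
  length w , s≤s (length-++-≤ˡ w) , i , s≤s (≤-trans i≤∣u∣ (m≤n+m _ 2)) , 2≤i ,
  cong (λ v → pow v i) (≡.sym (take-length-++ w (pow w i′)))
  where
  i≤∣u∣ : i ≤ length u
  i≤∣u∣ = subst (i ≤_) (≡.sym (length-pow w i)) (m≤m*n i (length w))

properPower? : Decidable ProperPower
properPower? u = map′ (λ (d , _ , i , _ , 2≤i , u≡) → take d u , i , 2≤i , u≡) properPower⇒bounded
  (anyUpTo? (λ d → anyUpTo? (λ i → (2 ≤? i) ×-dec (u ≟ʷ pow (take d u) i)) (3 + length u)) (suc (length u)))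

nword-1? : ∀ n k → Decidable (NWord n k 1)
nword-1? n k u = map′ (Equivalence.from (nword-1⇔primitive n k u)) (Equivalence.to (nword-1⇔primitive n k u))
  ((length u ℕ.≟ n) ×-dec (ones u ℕ.≟ k) ×-dec ¬? (properPower? u))

rotN-+ : ∀ i j u → rotN (i + j) u ≡ rotN j (rotN i u)
rotN-+ zero    j u = refl
rotN-+ (suc i) j u = rotN-+ i j (rot u)

rotN-++ : ∀ (xs ys : Word) → rotN (length xs) (xs ++ ys) ≡ ys ++ xs
rotN-++ []       ys = ≡.sym (++-identityʳ ys)
rotN-++ (x ∷ xs) ys = begin
  rotN (length xs) ((xs ++ ys) ++ [ x ])   ≡⟨ cong (rotN (length xs)) (++-assoc xs ys [ x ]) ⟩
  rotN (length xs) (xs ++ ys ++ [ x ])     ≡⟨ rotN-++ xs (ys ++ [ x ]) ⟩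
  (ys ++ [ x ]) ++ xs                      ≡⟨ ++-assoc ys [ x ] xs ⟩
  ys ++ x ∷ xs                             ∎
  where open ≡.≡-Reasoning

rotN-length : ∀ u → rotN (length u) u ≡ u
rotN-length u = ≡.trans (cong (rotN (length u)) (≡.sym (++-identityʳ u))) (rotN-++ u [])

rotN-*length : ∀ q u → rotN (q * length u) u ≡ u
rotN-*length zero    u = refl
rotN-*length (suc q) u = ≡.trans (rotN-+ (length u) (q * length u) u)
  (≡.trans (cong (rotN (q * length u)) (rotN-length u)) (rotN-*length q u))

rotN-[] : ∀ i → rotN i [] ≡ []
rotN-[] zero    = refl
rotN-[] (suc i) = rotN-[] i

∼-bounded : ∀ {u w} → u ∼ w → ∃[ i ] (i < suc (length u) × rotN i u ≡ w)
∼-bounded {[]}        (i , refl) = 0 , s≤s z≤n , ≡.sym (rotN-[] i)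
∼-bounded {u@(_ ∷ _)} (i , refl) = i % length u , m≤n⇒m≤1+n (m%n<n i (length u)) , (begin
  rotN (i % L) u                    ≡⟨ cong (rotN (i % L)) (rotN-*length (i / L) u) ⟨
  rotN (i % L) (rotN (i / L * L) u) ≡⟨ rotN-+ (i / L * L) (i % L) u ⟨
  rotN (i / L * L + i % L) u        ≡⟨ cong (λ j → rotN j u) (+-comm (i / L * L) (i % L)) ⟩
  rotN (i % L + i / L * L) u        ≡⟨ cong (λ j → rotN j u) (m≡m%n+[m/n]*n i L) ⟨
  rotN i u                          ∎)
  where
  L = length u
  open ≡.≡-Reasoning

∼-refl : ∀ {u} → u ∼ u
∼-refl = 0 , refl

∼-sym : ∀ {u w} → u ∼ w → w ∼ u
∼-sym {u} u∼w with i , i<1+L , refl ← ∼-bounded u∼w = length u ∸ i , (begin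
  rotN (length u ∸ i) (rotN i u)   ≡⟨ rotN-+ i (length u ∸ i) u ⟨
  rotN (i + (length u ∸ i)) u      ≡⟨ cong (λ j → rotN j u) (m+[n∸m]≡n (s≤s⁻¹ i<1+L)) ⟩
  rotN (length u) u                ≡⟨ rotN-length u ⟩
  u                                ∎)
  where open ≡.≡-Reasoning

∼-trans : ∀ {u v w} → u ∼ v → v ∼ w → u ∼ w
∼-trans {u} (i , refl) (j , refl) = i + j , rotN-+ i j u

infix 4 _∼?_
_∼?_ : (u w : Word) → Dec (u ∼ w)
u ∼? w = map′ (λ (i , _ , eq) → i , eq) ∼-bounded (anyUpTo? (λ i → rotN i u ≟ʷ w) (suc (length u)))

∼-decSetoid : DecSetoid _ _
∼-decSetoid = record
  { Carrier = Word
  ; _≈_ = _∼_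
  ; isDecEquivalence = record
    { isEquivalence = record { refl = ∼-refl ; sym = ∼-sym ; trans = ∼-trans }
    ; _≟_ = _∼?_
    }
  }

words : ℕ → List Word
words n = map toList (allVecs n)

∈-words : ∀ u → u ∈ words (length u)
∈-words u = subst (_∈ words (length u)) (toList∘fromList u) (∈-map⁺ toList (∈-allVecs (fromList u)))

necklaceCard-exists : ∀ n {P : Word → Set} → Decidable P → (∀ {u} → P u → length u ≡ n) →
  ∃[ m ] NecklaceCard P m
necklaceCard-exists n {P} P? length≡n =
  length reps , reps , refl , All.deduplicate⁺ _∼?_ (All.all-filter P? (words n)) ,
  deduplicate-! ∼-decSetoid (filter P? (words n)) , cover
  where
  reps = deduplicate _∼?_ (filter P? (words n))
  cover : ∀ u → P u → Any (u ∼_) reps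
  cover u Pu =
    ∈-deduplicate⁺ (DecSetoid.setoid ∼-decSetoid) _∼?_ (λ w∼v u∼v → ∼-trans u∼v (∼-sym w∼v))
    (Any.map (λ { refl → ∼-refl }) (∈-filter⁺ P? (subst (λ m → u ∈ words m) (length≡n Pu) (∈-words u)) Pu))

necklaceCard-cong : ∀ {P Q : Word → Set} → (∀ u → P u ⇔ Q u) →
  ∀ {m} → NecklaceCard P m → NecklaceCard Q m
necklaceCard-cong P⇔Q (reps , ∣reps∣≡m , all-P , distinct , cover) =
  reps , ∣reps∣≡m , All.map (Equivalence.to (P⇔Q _)) all-P , distinct ,
  λ u Qu → cover u (Equivalence.from (P⇔Q u) Qu)

necklace-equinumerous : ∀ n k r → gcd (gcd n k) r ≡ 1 →
  ∃[ m ] (NecklaceCard (NWord n k r) m × NecklaceCard (NWord n k 1) m)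
necklace-equinumerous n k r gcd≡1 =
  let m , card₁ = necklaceCard-exists n (nword-1? n k) proj₁
  in m , necklaceCard-cong (nword-1⇔nword-r gcd≡1) card₁ , card₁

proposition4p3 : (n k r : ℕ) → 2 ≤ n → k ≤ n → r < n → gcd (gcd n k) r ≡ 1 →
    (∃[ m ] (HasCard (SbarR n k r) m × HasCard (SbarR n k 1) m))
    × (∃[ m ] (NecklaceCard (NWord n k r) m × NecklaceCard (NWord n k 1) m))
proposition4p3 n@(suc _) k r _ _ _ gcd≡1 = sbar-equinumerous n k r gcd≡1 , necklace-equinumerous n k r gcd≡1
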